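{- Let $X$ be an abstract tectonic crater and let $\pi:Y\to X$ be a Galois covering of finite connected directed graphs. Color each edge $e$ of $Y$ with the color of $\pi(e)$, and for $v\in\mathbb{V}(Y)$ let $\mathfrak{b}_Y(v)$ (resp. $\mathfrak{g}_Y(v)$) be the target of the unique blue (resp. green) edge with source $v$. If $\mathfrak{b}_Y\circ\mathfrak{g}_Y=\mathfrak{g}_Y\circ\mathfrak{b}_Y$, then $Y$ is an abstract tectonic crater.
   Context: Abstract tectonic crater of parameters $(\mathfrak r,\mathfrak s,\mathfrak t,\mathfrak c)$ (nonnegative integers): a directed graph with $\mathfrak r\mathfrak s\mathfrak t$ vertices, each edge colored blue or green, such that each vertex is the source of exactly one blue and exactly one green edge and the target of exactly one blue and exactly one green edge; from each vertex there is exactly one closed blue (resp. green) path without backtracking of length $\mathfrak r\mathfrak s$ (resp. $\mathfrak r\mathfrak t$); and after every $\mathfrak s$ (resp. $\mathfrak c\mathfrak t$) steps along this blue (resp. green) path the two paths meet at a common vertex. An abstract tectonic crater is one for some parameters. A graph covering is a surjective morphism of graphs that is locally bijective (edges with source, resp. target, $v$ map bijectively onto those with source, resp. target, $\pi(v)$). A $d$-sheeted covering (each vertex of $X$ has $d$ preimages) is Galois if its group of deck transformations (automorphisms $\sigma$ of $Y$ with $\pi\circ\sigma=\pi$) has order $d$. -}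

module Defs where

open import Data.Nat using (ℕ; _*_)
open import Data.Fin using (Fin)
open import Data.Vec using (Vec; []; _∷_)
open import Data.Product using (Σ; ∃; _×_; _,_)
open import Relation.Binary.PropositionalEquality using (_≡_)
open import Relation.Binary.Construct.Closure.ReflexiveTransitive using (Star)
open import Relation.Binary.Construct.Closure.Symmetric using (SymClosure)
open import Function.Bundles using (_↔_)

ExactlyOne : {A : Set} → (A → Set) → Set
ExactlyOne {A} P = Σ A λ a → P a × (∀ a' → P a' → a' ≡ a)

record Graph : Set where
  field
    nV nE : ℕ
    src tgt : Fin nE → Fin nV
open Graph public

Adj : (G : Graph) → Fin (nV G) → Fin (nV G) → Set
Adj G u v = Σ (Fin (nE G)) λ e → src G e ≡ u × tgt G e ≡ v

Connected : Graph → Set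
Connected G = ∀ u v → Star (SymClosure (Adj G)) u v

data Color : Set where
  blue green : Color

Coloring : Graph → Set
Coloring G = Fin (nE G) → Color

IsWalk : (G : Graph) → Coloring G → Color → Fin (nV G) → {n : ℕ} →
         Vec (Fin (nE G)) n → Fin (nV G) → Set
IsWalk G col k v [] w = v ≡ w
IsWalk G col k v (e ∷ es) w = src G e ≡ v × col e ≡ k × IsWalk G col k (tgt G e) es w

record IsTectonicCraterWith (G : Graph) (col : Coloring G) (r s t c : ℕ) : Set where
  field
    vertexCount : nV G ≡ r * s * t
    blueOut  : ∀ v → ExactlyOne λ e → src G e ≡ v × col e ≡ blue
    greenOut : ∀ v → ExactlyOne λ e → src G e ≡ v × col e ≡ green
    blueIn   : ∀ v → ExactlyOne λ e → tgt G e ≡ v × col e ≡ blue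
    greenIn  : ∀ v → ExactlyOne λ e → tgt G e ≡ v × col e ≡ green
    blueCycle  : ∀ v → ExactlyOne λ (es : Vec (Fin (nE G)) (r * s)) → IsWalk G col blue v es v
    greenCycle : ∀ v → ExactlyOne λ (es : Vec (Fin (nE G)) (r * t)) → IsWalk G col green v es v
    meet : ∀ v (i : ℕ) (w₁ w₂ : Fin (nV G))
             (es : Vec (Fin (nE G)) (s * i)) (fs : Vec (Fin (nE G)) (c * t * i)) →
             IsWalk G col blue v es w₁ → IsWalk G col green v fs w₂ → w₁ ≡ w₂

IsTectonicCrater : (G : Graph) → Coloring G → Set
IsTectonicCrater G col = Σ ℕ λ r → Σ ℕ λ s → Σ ℕ λ t → Σ ℕ λ c → IsTectonicCraterWith G col r s t c

record Hom (Y X : Graph) : Set where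
  field
    fV : Fin (nV Y) → Fin (nV X)
    fE : Fin (nE Y) → Fin (nE X)
    src-comm : ∀ e → src X (fE e) ≡ fV (src Y e)
    tgt-comm : ∀ e → tgt X (fE e) ≡ fV (tgt Y e)
open Hom public

record IsCovering {Y X : Graph} (π : Hom Y X) : Set where
  field
    surjV : ∀ x → Σ (Fin (nV Y)) λ v → fV π v ≡ x
    surjE : ∀ e → Σ (Fin (nE Y)) λ e' → fE π e' ≡ e
    locSrc : ∀ v e → src X e ≡ fV π v →
               ExactlyOne λ e' → src Y e' ≡ v × fE π e' ≡ e
    locTgt : ∀ v e → tgt X e ≡ fV π v →
               ExactlyOne λ e' → tgt Y e' ≡ v × fE π e' ≡ e

record Deck {Y X : Graph} (π : Hom Y X) : Set where
  field
    σV  : Fin (nV Y) → Fin (nV Y)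
    σE  : Fin (nE Y) → Fin (nE Y)
    σV⁻ : Fin (nV Y) → Fin (nV Y)
    σE⁻ : Fin (nE Y) → Fin (nE Y)
    invVˡ : ∀ v → σV⁻ (σV v) ≡ v
    invVʳ : ∀ v → σV (σV⁻ v) ≡ v
    invEˡ : ∀ e → σE⁻ (σE e) ≡ e
    invEʳ : ∀ e → σE (σE⁻ e) ≡ e
    src-comm : ∀ e → src Y (σE e) ≡ σV (src Y e)
    tgt-comm : ∀ e → tgt Y (σE e) ≡ σV (tgt Y e)
    overV : ∀ v → fV π (σV v) ≡ fV π v
    overE : ∀ e → fE π (σE e) ≡ fE π e
open Deck public

_≈D_ : {Y X : Graph} {π : Hom Y X} → Deck π → Deck π → Set
_≈D_ {Y} σ τ = (∀ v → σV σ v ≡ σV τ v) × (∀ e → σE σ e ≡ σE τ e)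

DeckOrder : {Y X : Graph} (π : Hom Y X) → ℕ → Set
DeckOrder π d = Σ (Fin d → Deck π) λ f →
  (∀ i j → f i ≈D f j → i ≡ j) × (∀ σ → Σ (Fin d) λ i → f i ≈D σ)

-- Galois covering: d-sheeted covering whose deck group has order d
IsGalois : {Y X : Graph} (π : Hom Y X) → Set
IsGalois {Y} {X} π = IsCovering π × Σ ℕ λ d →
  (∀ x → Fin d ↔ (Σ (Fin (nV Y)) λ v → fV π v ≡ x)) × DeckOrder π d

pullColor : {Y X : Graph} → Hom Y X → Coloring X → Coloring Y
pullColor π col e = col (fE π e)

-- b_Y ∘ g_Y = g_Y ∘ b_Y, written out relationally via the edges realizing
-- b_Y and g_Y (these are the unique blue/green out-edges)
BGCommute : (G : Graph) → Coloring G → Set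
BGCommute G col = ∀ v (e₁ e₂ e₃ e₄ : Fin (nE G)) →
  src G e₁ ≡ v → col e₁ ≡ green → src G e₂ ≡ tgt G e₁ → col e₂ ≡ blue →
  src G e₃ ≡ v → col e₃ ≡ blue → src G e₄ ≡ tgt G e₃ → col e₄ ≡ green →
  tgt G e₂ ≡ tgt G e₄

{-# OPTIONS --safe #-}
-- Lifting along the covering, every vertex of Y has exactly one blue and one green edge
-- in and out, so b = 𝔟_Y and g = 𝔤_Y are commuting permutations of V(Y); by connectivity
-- every vertex is bⁱ gʲ v₀ for a fixed v₀.  Let n be the order of g at v₀ and s the least
-- s > 0 with bˢ v₀ = gˣ v₀ for some x.  As the shifts bⁱ gʲ commute and act transitively,
-- gⁿ = id and bˢ = gˣ hold everywhere, and (i , j) ↦ bⁱ gʲ v₀ is a bijection from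
-- [0, s) × [0, n) onto V(Y).  So Y is a tectonic crater with parameters (n, s, 1, x).

module Submission where

open import Defs
open import Data.Nat using (ℕ; zero; suc; _+_; _*_; _∸_; _≤_; _<_; s≤s; z<s; NonZero)
open import Data.Nat.Properties
  using (+-suc; +-identityʳ; *-comm; *-identityʳ; n<1+n; <⇒≤; ≤-<-trans; ≤-total; m≤n+m; m+n≤o⇒n≤o; m∸n+n≡m; m≤n⇒∃[o]m+o≡n; n≢0⇒n>0)
import Data.Nat.Properties as ℕ
open import Data.Nat.DivMod using (_%_; _/_; m≡m%n+[m/n]*n; m%n<n)
open import Data.Fin as Fin using (Fin; toℕ; fromℕ<)
open import Data.Fin.Properties using (pigeonhole; any?; _≟_; *↔×; toℕ-fromℕ<; toℕ<n; toℕ-injective; ¬Fin0)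
open import Data.Fin.Permutation using (↔⇒≡)
open import Data.Product as Product using (Σ; ∃; ∃₂; _×_; _,_; proj₁; proj₂)
open import Data.Empty using (⊥-elim)
open import Data.Vec using (Vec; []; _∷_)
open import Data.Sum using (inj₁; inj₂; [_,_]′)
open import Function.Base using (id; _∘_)
open import Function.Bundles using (mk⤖)
open import Function.Definitions using (Injective; StrictlySurjective)
open import Function.Consequences.Propositional using (strictlySurjective⇒surjective)
open import Function.Construct.Composition using (_↔-∘_)
open import Function.Properties.Bijection using (⤖⇒↔)
open import Relation.Nullary using (¬_; yes; no)
open import Relation.Unary using (Decidable)
open import Relation.Binary.PropositionalEquality
  using (_≡_; _≢_; _≗_; refl; sym; trans; cong; cong₂; cong-app; subst; module ≡-Reasoning)
open import Relation.Binary.Construct.Closure.ReflexiveTransitive using (Star; ε; _◅_)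
open import Relation.Binary.Construct.Closure.Symmetric using (SymClosure; fwd; bwd)

module _ {A : Set} where
  open import Function.Endo.Propositional A public using (_^_)
  open import Function.Endo.Propositional A using (^-homo)

  ^-+ : ∀ (f : A → A) m n → f ^ (m + n) ≗ (f ^ m) ∘ (f ^ n)
  ^-+ f m n = cong-app (^-homo f m n)

  ∘-^-commute : ∀ {f h : A → A} → f ∘ h ≗ h ∘ f → ∀ k → f ∘ (h ^ k) ≗ (h ^ k) ∘ f
  ∘-^-commute         fh zero    x = refl
  ∘-^-commute {f} {h} fh (suc k) x = trans (fh ((h ^ k) x)) (cong h (∘-^-commute fh k x))

  ^-commute : ∀ {f h : A → A} → f ∘ h ≗ h ∘ f → ∀ m k → (f ^ m) ∘ (h ^ k) ≗ (h ^ k) ∘ (f ^ m)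
  ^-commute {f} {h} fh m k x =
    sym (∘-^-commute {h ^ k} {f} (λ y → sym (∘-^-commute fh k y)) m x)

  ^-injective : ∀ {f : A → A} → Injective _≡_ _≡_ f → ∀ m → Injective _≡_ _≡_ (f ^ m)
  ^-injective inj zero    eq = eq
  ^-injective inj (suc m) eq = ^-injective inj m (inj eq)

  ^-*-≗ : ∀ {f h : A → A} {m k} → f ^ m ≗ h ^ k → ∀ i → f ^ (i * m) ≗ h ^ (i * k)
  ^-*-≗ {f} {h} {m} {k} eq zero    x = refl
  ^-*-≗ {f} {h} {m} {k} eq (suc i) x = begin
    (f ^ (m + i * m)) x        ≡⟨ ^-+ f m (i * m) x ⟩
    (f ^ m) ((f ^ (i * m)) x)  ≡⟨ cong (f ^ m) (^-*-≗ eq i x) ⟩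
    (f ^ m) ((h ^ (i * k)) x)  ≡⟨ eq _ ⟩
    (h ^ k) ((h ^ (i * k)) x)  ≡⟨ ^-+ h k (i * k) x ⟨
    (h ^ (k + i * k)) x        ∎
    where open ≡-Reasoning

  ^-*-id : ∀ {f : A → A} {n} → f ^ n ≗ id → ∀ i → f ^ (i * n) ≗ id
  ^-*-id         fn zero    x = refl
  ^-*-id {f} {n} fn (suc i) x = trans (^-+ f n (i * n) x) (trans (fn _) (^-*-id fn i x))

  ^-% : ∀ {f : A → A} {n} .{{_ : NonZero n}} → f ^ n ≗ id → ∀ a → f ^ a ≗ f ^ (a % n)
  ^-% {f} {n} fn a x = begin
    (f ^ a) x                               ≡⟨ cong (λ e → (f ^ e) x) (m≡m%n+[m/n]*n a n) ⟩
    (f ^ (a % n + a / n * n)) x             ≡⟨ ^-+ f (a % n) (a / n * n) x ⟩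
    (f ^ (a % n)) ((f ^ (a / n * n)) x)     ≡⟨ cong (f ^ (a % n)) (^-*-id fn (a / n) x) ⟩
    (f ^ (a % n)) x                         ∎
    where open ≡-Reasoning

  ^-inverse : ∀ {f : A → A} {n j} → f ^ n ≗ id → j ≤ n → (f ^ (n ∸ j)) ∘ (f ^ j) ≗ id
  ^-inverse {f} {n} {j} fn j≤n x = begin
    (f ^ (n ∸ j)) ((f ^ j) x)  ≡⟨ ^-+ f (n ∸ j) j x ⟨
    (f ^ (n ∸ j + j)) x        ≡⟨ cong (λ e → (f ^ e) x) (m∸n+n≡m j≤n) ⟩
    (f ^ n) x                  ≡⟨ fn x ⟩
    x                          ∎
    where open ≡-Reasoning

  ^-injective-within-period : ∀ {f : A → A} {x m} → Injective _≡_ _≡_ f →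
    (∀ {d} → d < m → (f ^ suc d) x ≢ x) →
    ∀ {j k} → j ≤ m → k ≤ m → (f ^ j) x ≡ (f ^ k) x → j ≡ k
  ^-injective-within-period {f} {x} {m} inj aperiodic {j} {k} j≤m k≤m fʲx≡fᵏx =
    [ (λ j≤k → ordered j≤k k≤m fʲx≡fᵏx) , (λ k≤j → sym (ordered k≤j j≤m (sym fʲx≡fᵏx))) ]′ (≤-total j k)
    where
    ordered : ∀ {j k} → j ≤ k → k ≤ m → (f ^ j) x ≡ (f ^ k) x → j ≡ k
    ordered {j} j≤k k≤m eq with m≤n⇒∃[o]m+o≡n j≤k
    ... | zero  , refl = sym (+-identityʳ j)
    ... | suc d , refl = ⊥-elim (aperiodic (m+n≤o⇒n≤o j k≤m)
                           (sym (^-injective inj j (trans eq (^-+ f j (suc d) x)))))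

injective⇒recurrent : ∀ {N} {f : Fin N → Fin N} → Injective _≡_ _≡_ f → ∀ x → ∃ λ p → (f ^ suc p) x ≡ x
injective⇒recurrent {N} {f} inj x with pigeonhole (n<1+n N) (λ i → (f ^ toℕ i) x)
... | i , j , i<j , fⁱx≡fʲx with m≤n⇒∃[o]m+o≡n i<j
...   | p , i+1+p≡j = p , ^-injective inj (toℕ i) (sym (begin
  (f ^ toℕ i) x                ≡⟨ fⁱx≡fʲx ⟩
  (f ^ toℕ j) x                ≡⟨ cong (λ e → (f ^ e) x) (trans (sym i+1+p≡j) (sym (+-suc (toℕ i) p))) ⟩
  (f ^ (toℕ i + suc p)) x      ≡⟨ ^-+ f (toℕ i) (suc p) x ⟩
  (f ^ toℕ i) ((f ^ suc p) x)  ∎))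
  where open ≡-Reasoning

∃-least : ∀ {P : ℕ → Set} → Decidable P → ∀ {k} → P k → ∃ λ m → P m × (∀ {j} → j < m → ¬ P j)
∃-least         P? {zero}  p = 0 , p , λ ()
∃-least {P = P} P? {suc k} p with P? 0
... | yes p₀ = 0 , p₀ , λ ()
... | no ¬p₀ with ∃-least {P = P ∘ suc} (P? ∘ suc) p
...   | m , pm , below = suc m , pm , λ { {zero} _ → ¬p₀ ; {suc j} (s≤s j<m) → below j<m }

bijective⇒≡* : ∀ {m n N} (f : Fin m × Fin n → Fin N) →
  Injective _≡_ _≡_ f → StrictlySurjective _≡_ f → N ≡ m * n
bijective⇒≡* f inj surj =
  sym (↔⇒≡ (⤖⇒↔ (mk⤖ (inj , strictlySurjective⇒surjective surj)) ↔-∘ *↔×))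

module TransitiveCommutingPair {N : ℕ} {b g : Fin N → Fin N}
  (b-injective : Injective _≡_ _≡_ b) (g-injective : Injective _≡_ _≡_ g)
  (b∘g≗g∘b : b ∘ g ≗ g ∘ b) (v₀ : Fin N)
  (reach : ∀ w → ∃₂ λ i j → w ≡ (b ^ i) ((g ^ j) v₀)) where

  shift : ℕ → ℕ → Fin N → Fin N
  shift i j = (b ^ i) ∘ (g ^ j)

  shift-commute : ∀ i j p q → shift i j ∘ shift p q ≗ shift p q ∘ shift i j
  shift-commute i j p q y = begin
    (b ^ i) ((g ^ j) ((b ^ p) ((g ^ q) y)))  ≡⟨ cong (b ^ i) (^-commute (sym ∘ b∘g≗g∘b) j p _) ⟩
    (b ^ i) ((b ^ p) ((g ^ j) ((g ^ q) y)))  ≡⟨ ^-commute (λ _ → refl) i p _ ⟩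
    (b ^ p) ((b ^ i) ((g ^ j) ((g ^ q) y)))  ≡⟨ cong ((b ^ p) ∘ (b ^ i)) (^-commute (λ _ → refl) j q y) ⟩
    (b ^ p) ((b ^ i) ((g ^ q) ((g ^ j) y)))  ≡⟨ cong (b ^ p) (^-commute b∘g≗g∘b i q _) ⟩
    (b ^ p) ((g ^ q) ((b ^ i) ((g ^ j) y)))  ∎
    where open ≡-Reasoning

  shift-≗ : ∀ {i j p q} → shift i j v₀ ≡ shift p q v₀ → shift i j ≗ shift p q
  shift-≗ {i} {j} {p} {q} eq w with reach w
  ... | k , l , refl = begin
    shift i j (shift k l v₀)  ≡⟨ shift-commute i j k l v₀ ⟩
    shift k l (shift i j v₀)  ≡⟨ cong (shift k l) eq ⟩
    shift k l (shift p q v₀)  ≡⟨ shift-commute k l p q v₀ ⟩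
    shift p q (shift k l v₀)  ∎
    where open ≡-Reasoning

  -- abstract keeps the type checker from unfolding the pigeonhole search.
  abstract
    g-period : ∃ λ m → (g ^ suc m) v₀ ≡ v₀ × ∀ {d} → d < m → (g ^ suc d) v₀ ≢ v₀
    g-period = ∃-least {P = λ m → (g ^ suc m) v₀ ≡ v₀} (λ m → (g ^ suc m) v₀ ≟ v₀)
      {proj₁ (injective⇒recurrent g-injective v₀)} (proj₂ (injective⇒recurrent g-injective v₀))

  n : ℕ
  n = suc (proj₁ g-period)

  instance
    n-nonZero : NonZero n
    n-nonZero = _

  g^n≗id : g ^ n ≗ id
  g^n≗id = shift-≗ {0} {n} {0} {0} (proj₁ (proj₂ g-period))

  g^-injective-below-n : ∀ {j k} → j < n → k < n → (g ^ j) v₀ ≡ (g ^ k) v₀ → j ≡ k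
  g^-injective-below-n (s≤s j≤m) (s≤s k≤m) =
    ^-injective-within-period g-injective (proj₂ (proj₂ g-period)) j≤m k≤m

  InGOrbit : Fin N → Set
  InGOrbit w = ∃ λ (j : Fin n) → w ≡ (g ^ toℕ j) v₀

  abstract
    b-return : ∃ λ m → InGOrbit ((b ^ suc m) v₀) × ∀ {d} → d < m → ¬ InGOrbit ((b ^ suc d) v₀)
    b-return = ∃-least {P = λ m → InGOrbit ((b ^ suc m) v₀)}
      (λ m → any? λ j → (b ^ suc m) v₀ ≟ (g ^ toℕ j) v₀)
      {proj₁ (injective⇒recurrent b-injective v₀)} (Fin.zero , proj₂ (injective⇒recurrent b-injective v₀))

  s x : ℕ
  s = suc (proj₁ b-return)
  x = toℕ (proj₁ (proj₁ (proj₂ b-return)))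

  b^s≗g^x : b ^ s ≗ g ^ x
  b^s≗g^x = shift-≗ {s} {0} {0} {x} (proj₂ (proj₁ (proj₂ b-return)))

  b^[n*s]≗id : b ^ (n * s) ≗ id
  b^[n*s]≗id v = begin
    (b ^ (n * s)) v  ≡⟨ ^-*-≗ {f = b} {g} {s} {x} b^s≗g^x n v ⟩
    (g ^ (n * x)) v  ≡⟨ cong (λ e → (g ^ e) v) (*-comm n x) ⟩
    (g ^ (x * n)) v  ≡⟨ ^-*-id g^n≗id x v ⟩
    v                ∎
    where open ≡-Reasoning

  b^-not-in-g-orbit : ∀ {d} j → 0 < d → d < s → (b ^ d) v₀ ≢ (g ^ j) v₀
  b^-not-in-g-orbit {suc d} j _ (s≤s d<m) eq = proj₂ (proj₂ b-return) d<m
    (fromℕ< (m%n<n j n) , trans eq (trans (^-% g^n≗id j v₀) (cong (λ e → (g ^ e) v₀) (sym (toℕ-fromℕ< (m%n<n j n))))))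

  shift-injective-≤ : ∀ {i j i' j'} → i ≤ i' → i' < s → j < n → j' < n →
    shift i j v₀ ≡ shift i' j' v₀ → i ≡ i' × j ≡ j'
  shift-injective-≤ {i} {j} {i'} {j'} i≤i' i'<s j<n j'<n eq with m≤n⇒∃[o]m+o≡n i≤i'
  ... | zero , refl =
    sym (+-identityʳ i) , g^-injective-below-n j<n j'<n (^-injective b-injective i (trans eq (^-+ b i 0 _)))
  ... | suc d , refl = ⊥-elim (b^-not-in-g-orbit (n ∸ j' + j) z<s (≤-<-trans (m≤n+m (suc d) i) i'<s) bᵈv₀-in-GOrbit)
    where
    open ≡-Reasoning
    gʲv₀≡bᵈgʲ'v₀ : (g ^ j) v₀ ≡ (b ^ suc d) ((g ^ j') v₀)
    gʲv₀≡bᵈgʲ'v₀ = ^-injective b-injective i (trans eq (^-+ b i (suc d) _))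
    bᵈv₀-in-GOrbit : (b ^ suc d) v₀ ≡ (g ^ (n ∸ j' + j)) v₀
    bᵈv₀-in-GOrbit = begin
      (b ^ suc d) v₀                              ≡⟨ ^-inverse g^n≗id (<⇒≤ j'<n) _ ⟨
      (g ^ (n ∸ j')) ((g ^ j') ((b ^ suc d) v₀))  ≡⟨ cong (g ^ (n ∸ j')) (^-commute b∘g≗g∘b (suc d) j' v₀) ⟨
      (g ^ (n ∸ j')) ((b ^ suc d) ((g ^ j') v₀))  ≡⟨ cong (g ^ (n ∸ j')) gʲv₀≡bᵈgʲ'v₀ ⟨
      (g ^ (n ∸ j')) ((g ^ j) v₀)                 ≡⟨ ^-+ g (n ∸ j') j v₀ ⟨
      (g ^ (n ∸ j' + j)) v₀                       ∎

  shift-injective : ∀ {i j i' j'} → i < s → i' < s → j < n → j' < n →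
    shift i j v₀ ≡ shift i' j' v₀ → i ≡ i' × j ≡ j'
  shift-injective {i} {i' = i'} i<s i'<s j<n j'<n eq with ≤-total i i'
  ... | inj₁ i≤i' = shift-injective-≤ i≤i' i'<s j<n j'<n eq
  ... | inj₂ i'≤i = Product.map sym sym (shift-injective-≤ i'≤i i<s j'<n j<n (sym eq))

  shift-reduce : ∀ i j → shift i j v₀ ≡ shift (i % s) ((i / s * x + j) % n) v₀
  shift-reduce i j = begin
    (b ^ i) ((g ^ j) v₀)                                   ≡⟨ cong (λ e → (b ^ e) ((g ^ j) v₀)) (m≡m%n+[m/n]*n i s) ⟩
    (b ^ (i % s + i / s * s)) ((g ^ j) v₀)                 ≡⟨ ^-+ b (i % s) (i / s * s) _ ⟩
    (b ^ (i % s)) ((b ^ (i / s * s)) ((g ^ j) v₀))         ≡⟨ cong (b ^ (i % s)) (^-*-≗ {f = b} {g} {s} {x} b^s≗g^x (i / s) _) ⟩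
    (b ^ (i % s)) ((g ^ (i / s * x)) ((g ^ j) v₀))         ≡⟨ cong (b ^ (i % s)) (^-+ g (i / s * x) j v₀) ⟨
    (b ^ (i % s)) ((g ^ (i / s * x + j)) v₀)               ≡⟨ cong (b ^ (i % s)) (^-% g^n≗id (i / s * x + j) v₀) ⟩
    (b ^ (i % s)) ((g ^ ((i / s * x + j) % n)) v₀)         ∎
    where open ≡-Reasoning

  coordinates : Fin s × Fin n → Fin N
  coordinates (i , j) = shift (toℕ i) (toℕ j) v₀

  coordinates-injective : Injective _≡_ _≡_ coordinates
  coordinates-injective {i , j} {i' , j'} eq =
    let i≡i' , j≡j' = shift-injective (toℕ<n i) (toℕ<n i') (toℕ<n j) (toℕ<n j') eq
    in cong₂ _,_ (toℕ-injective i≡i') (toℕ-injective j≡j')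

  coordinates-surjective : StrictlySurjective _≡_ coordinates
  coordinates-surjective w with reach w
  ... | i , j , refl = (fromℕ< (m%n<n i s) , fromℕ< (m%n<n (i / s * x + j) n)) , (begin
    shift (toℕ (fromℕ< (m%n<n i s))) (toℕ (fromℕ< (m%n<n (i / s * x + j) n))) v₀
      ≡⟨ cong₂ (λ k l → shift k l v₀) (toℕ-fromℕ< (m%n<n i s)) (toℕ-fromℕ< (m%n<n (i / s * x + j) n)) ⟩
    shift (i % s) ((i / s * x + j) % n) v₀
      ≡⟨ shift-reduce i j ⟨
    shift i j v₀ ∎)
    where open ≡-Reasoning

  N≡s*n : N ≡ s * n
  N≡s*n = bijective⇒≡* coordinates coordinates-injective coordinates-surjective

UniqueOut UniqueIn : (G : Graph) → Coloring G → Color → Set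
UniqueOut G col k = ∀ v → ExactlyOne λ e → src G e ≡ v × col e ≡ k
UniqueIn  G col k = ∀ v → ExactlyOne λ e → tgt G e ≡ v × col e ≡ k

module ColorRegular (G : Graph) (col : Coloring G)
  (out : ∀ k → UniqueOut G col k) (inc : ∀ k → UniqueIn G col k) where

  out-edge : Color → Fin (nV G) → Fin (nE G)
  out-edge k v = proj₁ (out k v)

  src-out-edge : ∀ k v → src G (out-edge k v) ≡ v
  src-out-edge k v = proj₁ (proj₁ (proj₂ (out k v)))

  col-out-edge : ∀ k v → col (out-edge k v) ≡ k
  col-out-edge k v = proj₂ (proj₁ (proj₂ (out k v)))

  out-edge-unique : ∀ {k v e} → src G e ≡ v → col e ≡ k → e ≡ out-edge k v
  out-edge-unique se ce = proj₂ (proj₂ (out _ _)) _ (se , ce)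

  in-edge-unique : ∀ {k v e} → tgt G e ≡ v → col e ≡ k → e ≡ proj₁ (inc k v)
  in-edge-unique te ce = proj₂ (proj₂ (inc _ _)) _ (te , ce)

  next : Color → Fin (nV G) → Fin (nV G)
  next k v = tgt G (out-edge k v)

  next-injective : ∀ k → Injective _≡_ _≡_ (next k)
  next-injective k {u} {w} eq = begin
    u                       ≡⟨ src-out-edge k u ⟨
    src G (out-edge k u)    ≡⟨ cong (src G) (trans (in-edge-unique eq (col-out-edge k u))
                                                   (sym (in-edge-unique refl (col-out-edge k w)))) ⟩
    src G (out-edge k w)    ≡⟨ src-out-edge k w ⟩
    w                       ∎
    where open ≡-Reasoning

  next-^-suc : ∀ k m v → (next k ^ m) (next k v) ≡ (next k ^ suc m) v
  next-^-suc k m v = sym (∘-^-commute {f = next k} {next k} (λ _ → refl) m v)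

  walk-target : ∀ {k m v w} (es : Vec (Fin (nE G)) m) → IsWalk G col k v es w → w ≡ (next k ^ m) v
  walk-target                 []       v≡w              = sym v≡w
  walk-target {k} {suc m} {v} (e ∷ es) (se , ce , walk) =
    trans (walk-target es walk) (trans (cong ((next k ^ m) ∘ tgt G) (out-edge-unique se ce)) (next-^-suc k m v))

  walk-exists : ∀ k m v → Σ (Vec (Fin (nE G)) m) λ es → IsWalk G col k v es ((next k ^ m) v)
  walk-exists k zero    v = [] , refl
  walk-exists k (suc m) v =
    let es , walk = walk-exists k m (next k v)
    in out-edge k v ∷ es , src-out-edge k v , col-out-edge k v , subst (IsWalk G col k _ es) (next-^-suc k m v) walk

  walks-unique : ∀ {k m v w w'} (es es' : Vec (Fin (nE G)) m) →
    IsWalk G col k v es w → IsWalk G col k v es' w' → es ≡ es'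
  walks-unique []       []         _                _                   = refl
  walks-unique (e ∷ es) (e' ∷ es') (se , ce , walk) (se' , ce' , walk') with
    trans (out-edge-unique se ce) (sym (out-edge-unique se' ce'))
  ... | refl = cong (e ∷_) (walks-unique es es' walk walk')

  closed-walk-unique : ∀ k m v → (next k ^ m) v ≡ v →
    ExactlyOne λ (es : Vec (Fin (nE G)) m) → IsWalk G col k v es v
  closed-walk-unique k m v closes =
    let es , walk = walk-exists k m v
    in es , subst (IsWalk G col k v es) closes walk , λ es' walk' → walks-unique es' es walk' walk

  isTectonicCraterWith : ∀ {r s t c} → nV G ≡ r * s * t →
    next blue ^ (r * s) ≗ id → next green ^ (r * t) ≗ id → next blue ^ s ≗ next green ^ (c * t) →
    IsTectonicCraterWith G col r s t c
  isTectonicCraterWith {r} {s} {t} {c} count blue-period green-period b^s≗g^ct = record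
    { vertexCount = count
    ; blueOut     = out blue
    ; greenOut    = out green
    ; blueIn      = inc blue
    ; greenIn     = inc green
    ; blueCycle   = λ v → closed-walk-unique blue (r * s) v (blue-period v)
    ; greenCycle  = λ v → closed-walk-unique green (r * t) v (green-period v)
    ; meet        = λ v i w₁ w₂ es fs blue-walk green-walk → begin
        w₁                               ≡⟨ walk-target es blue-walk ⟩
        (next blue ^ (s * i)) v          ≡⟨ cong (λ e → (next blue ^ e) v) (*-comm s i) ⟩
        (next blue ^ (i * s)) v          ≡⟨ ^-*-≗ b^s≗g^ct i v ⟩
        (next green ^ (i * (c * t))) v   ≡⟨ cong (λ e → (next green ^ e) v) (*-comm i (c * t)) ⟩
        (next green ^ (c * t * i)) v     ≡⟨ walk-target fs green-walk ⟨
        w₂                               ∎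
    }
    where open ≡-Reasoning

  next-commute : BGCommute G col → next blue ∘ next green ≗ next green ∘ next blue
  next-commute bgc v = bgc v (out-edge green v) (out-edge blue (next green v))
                             (out-edge blue v) (out-edge green (next blue v))
    (src-out-edge green v) (col-out-edge green v) (src-out-edge blue (next green v)) (col-out-edge blue (next green v))
    (src-out-edge blue v)  (col-out-edge blue v)  (src-out-edge green (next blue v)) (col-out-edge green (next blue v))

  adjacent⇒next : ∀ {u w} → Adj G u w → ∃ λ k → w ≡ next k u
  adjacent⇒next (e , se , te) = col e , trans (sym te) (cong (tgt G) (out-edge-unique se refl))

  module Reachability (b∘g≗g∘b : next blue ∘ next green ≗ next green ∘ next blue) (v₀ : Fin (nV G)) where

    Reachable : Fin (nV G) → Set
    Reachable w = ∃₂ λ i j → w ≡ (next blue ^ i) ((next green ^ j) v₀)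

    reachable-next : ∀ k {w} → Reachable w → Reachable (next k w)
    reachable-next blue  (i , j , refl) = suc i , j , refl
    reachable-next green (i , j , refl) = i , suc j , ∘-^-commute (sym ∘ b∘g≗g∘b) i _

    reachable-^ : ∀ k m {w} → Reachable w → Reachable ((next k ^ m) w)
    reachable-^ k zero    r = r
    reachable-^ k (suc m) r = reachable-next k (reachable-^ k m r)

    -- next k is a permutation of a finite set, so some iterate of it undoes a step.
    reachable-prev : ∀ k {w} → Reachable (next k w) → Reachable w
    reachable-prev k {w} r with injective⇒recurrent (next-injective k) w
    ... | p , returns = subst Reachable (trans (next-^-suc k p w) returns) (reachable-^ k p r)

    reachable-along : ∀ {u w} → Star (SymClosure (Adj G)) u w → Reachable u → Reachable w
    reachable-along ε              r = r
    reachable-along (fwd a ◅ path) r with adjacent⇒next a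
    ... | k , refl = reachable-along path (reachable-next k r)
    reachable-along (bwd a ◅ path) r with adjacent⇒next a
    ... | k , refl = reachable-along path (reachable-prev k r)

  isTectonicCrater : BGCommute G col → Connected G → IsTectonicCrater G col
  isTectonicCrater bgc connected with nV G ℕ.≟ 0
  ... | yes |V|≡0 = 0 , 0 , 0 , 0 , isTectonicCraterWith |V|≡0 (λ v → no-vertex v) (λ v → no-vertex v) (λ v → no-vertex v)
    where
    no-vertex : ∀ {A : Set} → Fin (nV G) → A
    no-vertex v = ⊥-elim (¬Fin0 (subst Fin |V|≡0 v))
  ... | no |V|≢0 = n , s , 1 , x , isTectonicCraterWith
      (trans N≡s*n (trans (*-comm s n) (sym (*-identityʳ (n * s)))))
      b^[n*s]≗id
      (subst (λ e → g ^ e ≗ id) (sym (*-identityʳ n)) g^n≗id)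
      (subst (λ e → b ^ s ≗ g ^ e) (sym (*-identityʳ x)) b^s≗g^x)
    where
    b = next blue
    g = next green
    v₀ = fromℕ< (n≢0⇒n>0 |V|≢0)
    b∘g≗g∘b = next-commute bgc
    open Reachability b∘g≗g∘b v₀
    open TransitiveCommutingPair (next-injective blue) (next-injective green) b∘g≗g∘b v₀
      (λ w → reachable-along (connected v₀ w) (0 , 0 , refl))

pullback-UniqueOut : ∀ {X Y colX k} {π : Hom Y X} → IsCovering π →
  UniqueOut X colX k → UniqueOut Y (pullColor π colX) k
pullback-UniqueOut {colX = colX} {π = π} cov unique v with unique (fV π v)
... | e , (se , ce) , e-unique with IsCovering.locSrc cov v e se
...   | e' , (se' , πe'≡e) , e'-unique = e' , (se' , trans (cong colX πe'≡e) ce) ,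
        λ a (sa , ca) → e'-unique a (sa , e-unique (fE π a) (trans (src-comm π a) (cong (fV π) sa) , ca))

pullback-UniqueIn : ∀ {X Y colX k} {π : Hom Y X} → IsCovering π →
  UniqueIn X colX k → UniqueIn Y (pullColor π colX) k
pullback-UniqueIn {colX = colX} {π = π} cov unique v with unique (fV π v)
... | e , (te , ce) , e-unique with IsCovering.locTgt cov v e te
...   | e' , (te' , πe'≡e) , e'-unique = e' , (te' , trans (cong colX πe'≡e) ce) ,
        λ a (ta , ca) → e'-unique a (ta , e-unique (fE π a) (trans (tgt-comm π a) (cong (fV π) ta) , ca))

lemma5p10 : (X Y : Graph) (colX : Coloring X) (π : Hom Y X) →
    IsTectonicCrater X colX → Connected X → Connected Y → IsGalois π →
    BGCommute Y (pullColor π colX) →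
    IsTectonicCrater Y (pullColor π colX)
lemma5p10 X Y colX π (_ , _ , _ , _ , crater) _ connectedY (covering , _) bgc =
  ColorRegular.isTectonicCrater Y (pullColor π colX) out inc bgc connectedY
  where
  open IsTectonicCraterWith crater
  out : ∀ k → UniqueOut Y (pullColor π colX) k
  out blue  = pullback-UniqueOut covering blueOut
  out green = pullback-UniqueOut covering greenOut
  inc : ∀ k → UniqueIn Y (pullColor π colX) k
  inc blue  = pullback-UniqueIn covering blueIn
  inc green = pullback-UniqueIn covering greenIn
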